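{- Let $M^{(\mu)}=(S_{ij})$ be a $J_2$-free $\mathbb{Z}_\mu$-scheme of order $(m,n)$. Then for all $i,g\in\{1,\dots,m\}$ and $j,h\in\{1,\dots,n\}$: the differences $x-y$ (with $x\neq y$) taken over all ordered pairs from $S_{ij}$ together with those taken over all ordered pairs from $S_{ih}$ (when $h\ne j$) are pairwise distinct elements of $\mathbb{Z}_\mu$; and likewise the differences arising within $S_{ij}$ together with those arising within $S_{gj}$ (when $g\ne i$) are pairwise distinct.
   Context: A $\mathbb{Z}_\mu$-scheme of order $(m,n)$ is an $m\times n$ array $(S_{ij})$ of subsets of $\mathbb{Z}_\mu$. For $C\subseteq\mathbb{Z}_\mu$, $\overline C$ is the circulant $(0,1)$-matrix of order $\mu$ (indices $0,\dots,\mu-1$) with entry $1$ at $(i,j)$ iff $j-i\pmod\mu\in C$; the blow-up of the scheme is the $m\mu\times n\mu$ block matrix with blocks $\overline{S_{ij}}$. The scheme is $J_2$-free if every $2\times2$ submatrix (two distinct rows, two distinct columns) of its blow-up contains an entry $0$. -}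

module Defs where

open import Data.Nat using (ℕ; _+_; _∸_; _%_; NonZero)
open import Data.Nat.DivMod using (m%n<n)
open import Data.Fin using (Fin; toℕ; fromℕ<)
open import Data.Fin.Subset using (Subset; _∈_)
open import Data.Product using (_×_)
open import Data.Sum using (_⊎_)
open import Relation.Binary.PropositionalEquality using (_≡_; _≢_)
open import Relation.Nullary using (¬_)

-- ℤ_μ is represented by Fin μ (μ ≥ 1); subtraction modulo μ.
_⊖_ : ∀ {μ} .{{_ : NonZero μ}} → Fin μ → Fin μ → Fin μ
_⊖_ {μ} x y = fromℕ< (m%n<n (toℕ x + (μ ∸ toℕ y)) μ)

Scheme : ℕ → ℕ → ℕ → Set
Scheme μ m n = Fin m → Fin n → Subset μ

-- Entry (r,c) of the circulant matrix C̄ is 1 iff c - r ∈ C.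
Circ : ∀ {μ} .{{_ : NonZero μ}} → Subset μ → Fin μ → Fin μ → Set
Circ C r c = (c ⊖ r) ∈ C

-- The blow-up: an (mμ)×(nμ) matrix; row index (a , r) stands for row a·μ + r,
-- column index (b , c) for column b·μ + c.  Entry is 1 iff this type is inhabited.
BlowUp : ∀ {μ m n} .{{_ : NonZero μ}} → Scheme μ m n →
         (Fin m × Fin μ) → (Fin n × Fin μ) → Set
BlowUp S (a Data.Product., r) (b Data.Product., c) = Circ (S a b) r c

J₂-free : ∀ {μ m n} .{{_ : NonZero μ}} → Scheme μ m n → Set
J₂-free {μ} {m} {n} S =
  ∀ (R₁ R₂ : Fin m × Fin μ) (C₁ C₂ : Fin n × Fin μ) → R₁ ≢ R₂ → C₁ ≢ C₂ →
  ¬ (BlowUp S R₁ C₁ × BlowUp S R₁ C₂ × BlowUp S R₂ C₁ × BlowUp S R₂ C₂)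

-- The differences x - y (x ≠ y, x,y ∈ F k) over all k with P k, indexed by
-- (k , x , y), are pairwise distinct elements of ℤ_μ.
DiffsPairwiseDistinct : ∀ {μ} .{{_ : NonZero μ}} {K : Set} →
                        (K → Set) → (K → Subset μ) → Set
DiffsPairwiseDistinct {μ} {K = K} P F =
  ∀ (k k' : K) → P k → P k' → ∀ (x y u v : Fin μ) →
  x ∈ F k → y ∈ F k → u ∈ F k' → v ∈ F k' → x ≢ y → u ≢ v →
  x ⊖ y ≡ u ⊖ v → k ≡ k' × x ≡ u × y ≡ v

module Submission where

-- A 2×2 all-ones submatrix of the blow-up is a "rectangle":
-- rows (a , r₁), (a' , r₂) and columns (b , c₁), (b' , c₂) with every
-- cᵥ ⊖ rᵤ in the corresponding S.  J₂-freeness says that any such rectangle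
-- is degenerate: if its rows differ, its columns coincide, and vice versa.
--
-- Suppose x - y = u - v with x ≠ y, x,y ∈ S i k and u,v ∈ S i k' (same row
-- block i).  Rows (i , 0) and (i , x - y) are distinct, and columns (k , x),
-- (k' , u) meet both in ones (since x - (x - y) = y and u - (u - v) = v), so
-- the columns coincide: k = k', x = u, hence y = v.  Dually, for x,y ∈ S k j
-- and u,v ∈ S k' j, the distinct columns (j , x), (j , y) meet rows (k , 0)
-- and (k' , x - u) in ones (using x - u = y - v), so the rows coincide.

open import Defs
open import Data.Nat using (ℕ; NonZero; _+_; _∸_; _%_; >-nonZero⁻¹)
open import Data.Nat.Properties using (+-comm; +-assoc; +-identityʳ; m∸n+n≡m; m+[n∸m]≡n; <⇒≤)
open import Data.Nat.DivMod using (m%n<n; m%n%n≡m%n; %-distribˡ-+; [m+n]%n≡m%n; m<n⇒m%n≡m)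
open import Data.Fin using (Fin; toℕ; fromℕ<; _≟_)
open import Data.Fin.Properties using (toℕ-injective; toℕ-fromℕ<; toℕ<n)
open import Data.Fin.Subset using (Subset; _∈_)
open import Data.Product using (_×_; _,_)
open import Data.Product.Properties using (≡-dec; ,-injectiveˡ; ,-injectiveʳ)
open import Data.Sum using (_⊎_)
open import Relation.Binary.PropositionalEquality
  using (_≡_; _≢_; sym; trans; cong; subst; module ≡-Reasoning)
open import Relation.Nullary.Decidable using (decidable-stable)

module _ {μ : ℕ} .{{_ : NonZero μ}} where

  infix 4 _≡ₘ_
  _≡ₘ_ : ℕ → ℕ → Set
  a ≡ₘ b = a % μ ≡ b % μ

  +-congʳ-≡ₘ : ∀ {a b} c → a ≡ₘ b → a + c ≡ₘ b + c
  +-congʳ-≡ₘ {a} {b} c a≡b = begin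
    (a + c) % μ                ≡⟨ %-distribˡ-+ a c μ ⟩
    (a % μ + c % μ) % μ        ≡⟨ cong (λ t → (t + c % μ) % μ) a≡b ⟩
    (b % μ + c % μ) % μ        ≡⟨ %-distribˡ-+ b c μ ⟨
    (b + c) % μ                ∎
    where open ≡-Reasoning

  +-congˡ-≡ₘ : ∀ {a b} c → a ≡ₘ b → c + a ≡ₘ c + b
  +-congˡ-≡ₘ {a} {b} c a≡b = begin
    (c + a) % μ   ≡⟨ cong (_% μ) (+-comm c a) ⟩
    (a + c) % μ   ≡⟨ +-congʳ-≡ₘ c a≡b ⟩
    (b + c) % μ   ≡⟨ cong (_% μ) (+-comm b c) ⟩
    (c + b) % μ   ∎
    where open ≡-Reasoning

  ≡ₘ⇒≡ : ∀ {s t : Fin μ} → toℕ s ≡ₘ toℕ t → s ≡ t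
  ≡ₘ⇒≡ {s} {t} s≡t = toℕ-injective (begin
    toℕ s          ≡⟨ m<n⇒m%n≡m (toℕ<n s) ⟨
    toℕ s % μ      ≡⟨ s≡t ⟩
    toℕ t % μ      ≡⟨ m<n⇒m%n≡m (toℕ<n t) ⟩
    toℕ t          ∎)
    where open ≡-Reasoning

  0F : Fin μ
  0F = fromℕ< (>-nonZero⁻¹ μ)

  ⊖-spec : ∀ (a b : Fin μ) → toℕ (a ⊖ b) + toℕ b ≡ₘ toℕ a
  ⊖-spec a b = begin
    (toℕ (a ⊖ b) + toℕ b) % μ         ≡⟨ cong (λ t → (t + toℕ b) % μ) (toℕ-fromℕ< (m%n<n d μ)) ⟩
    (d % μ + toℕ b) % μ               ≡⟨ +-congʳ-≡ₘ (toℕ b) (m%n%n≡m%n d μ) ⟩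
    (d + toℕ b) % μ                   ≡⟨ cong (_% μ) (+-assoc (toℕ a) (μ ∸ toℕ b) (toℕ b)) ⟩
    (toℕ a + (μ ∸ toℕ b + toℕ b)) % μ ≡⟨ cong (λ t → (toℕ a + t) % μ) (m∸n+n≡m (<⇒≤ (toℕ<n b))) ⟩
    (toℕ a + μ) % μ                   ≡⟨ [m+n]%n≡m%n (toℕ a) μ ⟩
    toℕ a % μ                         ∎
    where
    open ≡-Reasoning
    d = toℕ a + (μ ∸ toℕ b)

  ⊖-unique : ∀ (t a b : Fin μ) → toℕ t + toℕ b ≡ₘ toℕ a → t ≡ a ⊖ b
  ⊖-unique t a b t+b≡a = ≡ₘ⇒≡ (begin
    toℕ t % μ                               ≡⟨ [m+n]%n≡m%n (toℕ t) μ ⟨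
    (toℕ t + μ) % μ                         ≡⟨ cong (λ s → (toℕ t + s) % μ) (m+[n∸m]≡n (<⇒≤ (toℕ<n b))) ⟨
    (toℕ t + (toℕ b + (μ ∸ toℕ b))) % μ     ≡⟨ cong (_% μ) (+-assoc (toℕ t) (toℕ b) (μ ∸ toℕ b)) ⟨
    (toℕ t + toℕ b + (μ ∸ toℕ b)) % μ       ≡⟨ +-congʳ-≡ₘ (μ ∸ toℕ b) t+b≡a ⟩
    (toℕ a + (μ ∸ toℕ b)) % μ               ≡⟨ m%n%n≡m%n (toℕ a + (μ ∸ toℕ b)) μ ⟨
    (toℕ a + (μ ∸ toℕ b)) % μ % μ           ≡⟨ cong (_% μ) (toℕ-fromℕ< (m%n<n (toℕ a + (μ ∸ toℕ b)) μ)) ⟨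
    toℕ (a ⊖ b) % μ                         ∎)
    where open ≡-Reasoning

  ⊖-identityʳ : ∀ (a : Fin μ) → a ⊖ 0F ≡ a
  ⊖-identityʳ a = sym (⊖-unique a a 0F (begin
    (toℕ a + toℕ 0F) % μ   ≡⟨ cong (λ t → (toℕ a + t) % μ) (toℕ-fromℕ< (>-nonZero⁻¹ μ)) ⟩
    (toℕ a + 0) % μ        ≡⟨ cong (_% μ) (+-identityʳ (toℕ a)) ⟩
    toℕ a % μ              ∎))
    where open ≡-Reasoning

  ⊖-involutive : ∀ (a b : Fin μ) → a ⊖ (a ⊖ b) ≡ b
  ⊖-involutive a b = sym (⊖-unique b a (a ⊖ b) (trans (cong (_% μ) (+-comm (toℕ b) _)) (⊖-spec a b)))

  ⊖-cancelˡ : ∀ (a : Fin μ) {b c : Fin μ} → a ⊖ b ≡ a ⊖ c → b ≡ c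
  ⊖-cancelˡ a {b} {c} e = trans (sym (⊖-involutive a b)) (trans (cong (a ⊖_) e) (⊖-involutive a c))

  ⊖≡0⇒≡ : ∀ (a b : Fin μ) → a ⊖ b ≡ 0F → a ≡ b
  ⊖≡0⇒≡ a b e = begin
    a              ≡⟨ ⊖-identityʳ a ⟨
    a ⊖ 0F         ≡⟨ cong (a ⊖_) e ⟨
    a ⊖ (a ⊖ b)    ≡⟨ ⊖-involutive a b ⟩
    b              ∎
    where open ≡-Reasoning

  ⊖-parallelogram : ∀ (x y u v : Fin μ) → x ⊖ y ≡ u ⊖ v → x ⊖ u ≡ y ⊖ v
  ⊖-parallelogram x y u v e = sym (⊖-unique (y ⊖ v) x u (begin
    (w + toℕ u) % μ          ≡⟨ +-congˡ-≡ₘ w d+v≡u ⟨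
    (w + (d + toℕ v)) % μ    ≡⟨ cong (_% μ) rearrange ⟩
    (w + toℕ v + d) % μ      ≡⟨ +-congʳ-≡ₘ d (⊖-spec y v) ⟩
    (toℕ y + d) % μ          ≡⟨ cong (_% μ) (+-comm (toℕ y) d) ⟩
    (d + toℕ y) % μ          ≡⟨ ⊖-spec x y ⟩
    toℕ x % μ                ∎))
    where
    open ≡-Reasoning
    w = toℕ (y ⊖ v)
    d = toℕ (x ⊖ y)
    d+v≡u : d + toℕ v ≡ₘ toℕ u
    d+v≡u = trans (cong (λ t → (toℕ t + toℕ v) % μ) e) (⊖-spec u v)
    rearrange : w + (d + toℕ v) ≡ w + toℕ v + d
    rearrange = trans (cong (w +_) (+-comm d (toℕ v))) (sym (+-assoc w (toℕ v) d))

  circ-entry : ∀ {C : Subset μ} (r c : Fin μ) {z : Fin μ} → c ⊖ r ≡ z → z ∈ C → Circ C r c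
  circ-entry {C} r c c⊖r≡z z∈C = subst (_∈ C) (sym c⊖r≡z) z∈C

  Rectangle : ∀ {m n} → Scheme μ m n → (R₁ R₂ : Fin m × Fin μ) (C₁ C₂ : Fin n × Fin μ) → Set
  Rectangle S R₁ R₂ C₁ C₂ =
    BlowUp S R₁ C₁ × BlowUp S R₁ C₂ × BlowUp S R₂ C₁ × BlowUp S R₂ C₂

  rectangle-sameColumns : ∀ {m n} {S : Scheme μ m n} → J₂-free S →
    ∀ {R₁ R₂ C₁ C₂} → R₁ ≢ R₂ → Rectangle S R₁ R₂ C₁ C₂ → C₁ ≡ C₂
  rectangle-sameColumns free {R₁} {R₂} {C₁} {C₂} R₁≢R₂ ones =
    decidable-stable (≡-dec _≟_ _≟_ C₁ C₂) (λ C₁≢C₂ → free R₁ R₂ C₁ C₂ R₁≢R₂ C₁≢C₂ ones)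

  rectangle-sameRows : ∀ {m n} {S : Scheme μ m n} → J₂-free S →
    ∀ {R₁ R₂ C₁ C₂} → C₁ ≢ C₂ → Rectangle S R₁ R₂ C₁ C₂ → R₁ ≡ R₂
  rectangle-sameRows free {R₁} {R₂} {C₁} {C₂} C₁≢C₂ ones =
    decidable-stable (≡-dec _≟_ _≟_ R₁ R₂) (λ R₁≢R₂ → free R₁ R₂ C₁ C₂ R₁≢R₂ C₁≢C₂ ones)

  rowDifferencesDistinct : ∀ {m n} {S : Scheme μ m n} → J₂-free S →
    ∀ (i : Fin m) {P : Fin n → Set} → DiffsPairwiseDistinct P (S i)
  rowDifferencesDistinct {S = S} free i k k' _ _ x y u v x∈ y∈ u∈ v∈ x≢y _ x-y≡u-v =
    ,-injectiveˡ columnsEqual , x≡u , ⊖-cancelˡ x (trans x-y≡u-v (cong (_⊖ v) (sym x≡u)))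
    where
    rowsDistinct : (i , 0F) ≢ (i , x ⊖ y)
    rowsDistinct eq = x≢y (⊖≡0⇒≡ x y (sym (,-injectiveʳ eq)))
    ones : Rectangle S (i , 0F) (i , x ⊖ y) (k , x) (k' , u)
    ones = circ-entry 0F x (⊖-identityʳ x) x∈
         , circ-entry 0F u (⊖-identityʳ u) u∈
         , circ-entry (x ⊖ y) x (⊖-involutive x y) y∈
         , circ-entry (x ⊖ y) u (trans (cong (u ⊖_) x-y≡u-v) (⊖-involutive u v)) v∈
    columnsEqual : (k , x) ≡ (k' , u)
    columnsEqual = rectangle-sameColumns free rowsDistinct ones
    x≡u : x ≡ u
    x≡u = ,-injectiveʳ columnsEqual

  columnDifferencesDistinct : ∀ {m n} {S : Scheme μ m n} → J₂-free S →
    ∀ (j : Fin n) {P : Fin m → Set} → DiffsPairwiseDistinct P (λ k → S k j)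
  columnDifferencesDistinct {S = S} free j k k' _ _ x y u v x∈ y∈ u∈ v∈ x≢y _ x-y≡u-v =
    ,-injectiveˡ rowsEqual , ⊖≡0⇒≡ x u x-u≡0 , ⊖≡0⇒≡ y v (trans (sym x-u≡y-v) x-u≡0)
    where
    x-u≡y-v : x ⊖ u ≡ y ⊖ v
    x-u≡y-v = ⊖-parallelogram x y u v x-y≡u-v
    ones : Rectangle S (k , 0F) (k' , x ⊖ u) (j , x) (j , y)
    ones = circ-entry 0F x (⊖-identityʳ x) x∈
         , circ-entry 0F y (⊖-identityʳ y) y∈
         , circ-entry (x ⊖ u) x (⊖-involutive x u) u∈
         , circ-entry (x ⊖ u) y (trans (cong (y ⊖_) x-u≡y-v) (⊖-involutive y v)) v∈
    rowsEqual : (k , 0F) ≡ (k' , x ⊖ u)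
    rowsEqual = rectangle-sameRows free (λ eq → x≢y (,-injectiveʳ eq)) ones
    x-u≡0 : x ⊖ u ≡ 0F
    x-u≡0 = sym (,-injectiveʳ rowsEqual)

mainTheorem5 : ∀ (μ m n : ℕ) .{{_ : NonZero μ}} (S : Scheme μ m n) → J₂-free S →
    ∀ (i g : Fin m) (j h : Fin n) →
      DiffsPairwiseDistinct (λ k → k ≡ j ⊎ k ≡ h) (λ k → S i k)
      × DiffsPairwiseDistinct (λ k → k ≡ i ⊎ k ≡ g) (λ k → S k j)
mainTheorem5 μ m n S free i g j h =
  rowDifferencesDistinct free i , columnDifferencesDistinct free j
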